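{- Let $G$ be a $K_4$-minor-free graph and $C$ a positive integer. If $P$ is a $C$-pocket of $G$ with coboundary $\{a,b\}$ such that the graph obtained from $G$ by adding an edge between $a$ and $b$ has no $K_4$ minor, then $P$ is $4$-deletable.
   Context: For an induced subgraph $H$ of $G$, the coboundary of $H$ is the set of vertices of $G - V(H)$ having a neighbour in $V(H)$. $H$ is a $C$-pocket if $H$ is a connected induced subgraph, $v(H)\le C$, and $d_G(v)\le C$ for all $v\in V(H)$. A non-empty induced subgraph $H$ of $G$ is $r$-deletable if for every list assignment $L$ of $H$ with $|L(v)|\ge r-(d_G(v)-d_H(v))$ for all $v\in V(H)$, $H$ has a proper colouring $f$ with $f(v)\in L(v)$. -}

module Defs where

open import Data.Nat using (ℕ; _≤_; _∸_)
open import Data.Fin using (Fin; _≟_)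
open import Data.Bool using (Bool; true; false; _∧_; _∨_; if_then_else_)
open import Data.List using (List; map; length; allFin)
open import Data.Nat.ListAction using (sum)
open import Data.List.Membership.Propositional using (_∈_)
open import Data.List.Relation.Unary.Unique.Propositional using (Unique)
open import Data.Maybe using (Maybe; just)
open import Data.Product using (Σ; ∃; _×_)
open import Data.Sum using (_⊎_)
open import Relation.Nullary using (¬_)
open import Relation.Nullary.Decidable using (⌊_⌋)
open import Relation.Binary.PropositionalEquality using (_≡_; _≢_)

Graph : ℕ → Set
Graph n = Fin n → Fin n → Bool

record Simple {n : ℕ} (G : Graph n) : Set where
  field
    sym     : ∀ u v → G u v ≡ G v u
    irrefl  : ∀ v → G v v ≡ false

-- vertex subsets (determine induced subgraphs)
Subset : ℕ → Set
Subset n = Fin n → Bool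

size : {n : ℕ} → Subset n → ℕ
size {n} S = sum (map (λ u → if S u then 1 else 0) (allFin n))

degIn : {n : ℕ} → Graph n → Subset n → Fin n → ℕ
degIn {n} G S v = sum (map (λ u → if G v u ∧ S u then 1 else 0) (allFin n))

deg : {n : ℕ} → Graph n → Fin n → ℕ
deg G v = degIn G (λ _ → true) v

-- walks in G all of whose vertices satisfy P (the first vertex is checked separately)
data PathIn {n : ℕ} (G : Graph n) (P : Fin n → Set) : Fin n → Fin n → Set where
  here : ∀ {u} → PathIn G P u u
  step : ∀ {u w v} → G u w ≡ true → P w → PathIn G P w v → PathIn G P u v

Connected : {n : ℕ} → Graph n → (Fin n → Set) → Set
Connected {n} G P =
  (Σ (Fin n) P) × (∀ u v → P u → P v → PathIn G P u v)

-- G has a K4 minor: a model with four disjoint non-empty connected branch sets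
-- β⁻¹(just i), i ∈ Fin 4, pairwise joined by an edge.
HasK4Minor : {n : ℕ} → Graph n → Set
HasK4Minor {n} G = Σ (Fin n → Maybe (Fin 4)) λ β →
  (∀ i → Connected G (λ v → β v ≡ just i)) ×
  (∀ i j → i ≢ j → Σ (Fin n) λ u → Σ (Fin n) λ v →
      β u ≡ just i × β v ≡ just j × G u v ≡ true)

K4MinorFree : {n : ℕ} → Graph n → Set
K4MinorFree G = ¬ HasK4Minor G

addEdge : {n : ℕ} → Graph n → Fin n → Fin n → Graph n
addEdge G a b x y =
  G x y ∨ ((⌊ x ≟ a ⌋ ∧ ⌊ y ≟ b ⌋) ∨ (⌊ x ≟ b ⌋ ∧ ⌊ y ≟ a ⌋))

IsPocket : {n : ℕ} → Graph n → ℕ → Subset n → Set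
IsPocket G C S =
  Connected G (λ v → S v ≡ true) × size S ≤ C × (∀ v → S v ≡ true → deg G v ≤ C)

CoboundaryIs : {n : ℕ} → Graph n → Subset n → Fin n → Fin n → Set
CoboundaryIs {n} G S a b =
  a ≢ b ×
  (∀ w → (S w ≡ false × Σ (Fin n) (λ u → S u ≡ true × G w u ≡ true)) → (w ≡ a ⊎ w ≡ b)) ×
  (∀ w → (w ≡ a ⊎ w ≡ b) → (S w ≡ false × Σ (Fin n) (λ u → S u ≡ true × G w u ≡ true)))

ListAssignment : ℕ → Set
ListAssignment n = Fin n → List ℕ

Deletable : {n : ℕ} → ℕ → Graph n → Subset n → Set
Deletable {n} r G S =
  Σ (Fin n) (λ v → S v ≡ true) ×
  (∀ (L : ListAssignment n) →
     (∀ v → S v ≡ true → Unique (L v)) →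
     (∀ v → S v ≡ true → r ∸ (deg G v ∸ degIn G S v) ≤ length (L v)) →
     Σ (Fin n → ℕ) λ f →
       (∀ v → S v ≡ true → f v ∈ L v) ×
       (∀ u v → S u ≡ true → S v ≡ true → G u v ≡ true → f u ≢ f v))

{-# OPTIONS --safe #-}
-- Colour the pocket greedily: it suffices that every non-empty T ⊆ V(P) contains a vertex v with
-- d_T(v) + (d_G(v) − d_P(v)) ≤ 3, because then L(v) has more colours than v has neighbours in T.
-- If some T had no such vertex, every vertex of T would have at least three neighbours in
-- T ∪ {a, b}, since its neighbours outside P lie in the coboundary {a, b}. A rooted form of
-- Dirac's theorem then gives a K4 minor of G + ab, a contradiction: if every vertex of V other
-- than the roots a ≠ b has three neighbours in V (and there is such a vertex), then G + ab has a
-- K4 minor inside V.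
--
-- The rooted theorem is proved by induction on |V|. Let K be a component of V − {a, b}. If K
-- touches both roots, take an a–b path through K that has no shortcut at its first inner vertex
-- c₁; then c₁ has a neighbour off the path, whose component in V minus the path either attaches
-- to three points of the path (branch sets: that component and three arcs of the path, the last
-- and first arc joined by ab) or to at most two points p, q. In the latter case, and when K
-- touches at most one root, a component K′ is cut off by two vertices p, q, and K′ ∪ {p, q} with
-- roots p, q is a smaller instance; its K4 minor in G + pq lifts to G + ab by replacing the edge
-- pq with a path from p to q outside K′ ∪ {p, q}.
module Submission where

open import Defs
open import Data.Nat using (ℕ; zero; suc; _+_; _∸_; _≤_; _<_; z≤n; s≤s; s≤s⁻¹; _≤?_; _<?_)
open import Data.Nat.Properties renaming (_≟_ to _≟ⁿ_)
open import Data.Nat.ListAction using (sum)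
open import Data.Bool using (Bool; true; false; _∧_; _∨_; not; if_then_else_)
open import Data.Bool.Properties
  using (∧-comm; ∨-comm; ∨-zeroʳ; ∧-conicalˡ; ∧-conicalʳ; ∧-identityʳ; ∧-zeroʳ; ¬-not;
         not-injective)
  renaming (_≟_ to _≟ᵇ_)
open import Data.Fin using (Fin; _≟_) renaming (suc to fsuc)
open import Data.Fin.Patterns using (0F; 1F; 2F; 3F)
open import Data.Fin.Properties using (any?)
open import Data.List using (List; []; _∷_; allFin; length; filter; map)
open import Data.List.Properties using (length-tabulate; length-map; filter-notAll)
open import Data.List.Membership.Propositional using (_∈_; _∉_; find)
open import Data.List.Membership.Propositional.Properties using (∈-allFin; ∈-filter⁺; ∈-map⁺)
open import Data.List.Membership.DecPropositional _≟ⁿ_ using (_∈?_)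
open import Data.List.Relation.Unary.Any as Any using (here; there)
open import Data.List.Relation.Unary.All as All using (All; _∷_)
open import Data.List.Relation.Unary.AllPairs using (_∷_)
open import Data.List.Relation.Unary.Unique.Propositional using (Unique)
open import Data.List.Relation.Unary.Unique.Propositional.Properties using (allFin⁺)
open import Data.Maybe using (Maybe; just; nothing)
open import Data.Maybe.Properties using (just-injective)
open import Data.Product using (Σ; ∃; _×_; _,_; proj₁; proj₂)
open import Data.Sum using (_⊎_; inj₁; inj₂)
import Data.Sum as Sum
open import Function using (id)
open import Relation.Binary.Definitions using (tri<; tri≈; tri>)
open import Relation.Binary.PropositionalEquality
open import Relation.Nullary using (Dec; yes; no; ¬_; ¬?; contradiction)
open import Relation.Nullary.Decidable using (⌊_⌋; _×-dec_; _⊎-dec_; decidable-stable; toSum)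

≡true⇒≢false : ∀ {x} → x ≡ true → x ≢ false
≡true⇒≢false refl ()

∧-intro : ∀ {x y} → x ≡ true → y ≡ true → x ∧ y ≡ true
∧-intro refl refl = refl

module _ {A : Set} where

  toWitness′ : (A? : Dec A) → ⌊ A? ⌋ ≡ true → A
  toWitness′ (yes a) _ = a

  fromWitness′ : (A? : Dec A) → A → ⌊ A? ⌋ ≡ true
  fromWitness′ (yes _) _ = refl
  fromWitness′ (no ¬a) a = contradiction a ¬a

  fromWitnessFalse′ : (A? : Dec A) → ¬ A → ⌊ A? ⌋ ≡ false
  fromWitnessFalse′ (yes a) ¬a = contradiction a ¬a
  fromWitnessFalse′ (no _) _ = refl

  toWitnessFalse′ : (A? : Dec A) → not ⌊ A? ⌋ ≡ true → ¬ A
  toWitnessFalse′ (no ¬a) _ = ¬a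

module _ {n : ℕ} where

  infix 4 _⊆_
  infixl 6 _∖_

  _⊆_ : Subset n → Subset n → Set
  S ⊆ T = ∀ v → S v ≡ true → T v ≡ true

  ⟦_⟧ : {P : Fin n → Set} → (∀ v → Dec (P v)) → Subset n
  ⟦ P? ⟧ v = ⌊ P? v ⌋

  module _ {P : Fin n → Set} (P? : ∀ v → Dec (P v)) {v : Fin n} where

    ⟦⟧⁻ : ⟦ P? ⟧ v ≡ true → P v
    ⟦⟧⁻ = toWitness′ (P? v)

    ⟦⟧⁺ : P v → ⟦ P? ⟧ v ≡ true
    ⟦⟧⁺ = fromWitness′ (P? v)

    ⟦⟧-false : ¬ P v → ⟦ P? ⟧ v ≡ false
    ⟦⟧-false = fromWitnessFalse′ (P? v)

  _∖_ : Subset n → Subset n → Subset n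
  S ∖ T = ⟦ (λ v → S v ≟ᵇ true ×-dec T v ≟ᵇ false) ⟧

  ∖⁻ : ∀ S T {v} → (S ∖ T) v ≡ true → S v ≡ true × T v ≡ false
  ∖⁻ S T = ⟦⟧⁻ (λ v → S v ≟ᵇ true ×-dec T v ≟ᵇ false)

  ∖⁺ : ∀ S T {v} → S v ≡ true → T v ≡ false → (S ∖ T) v ≡ true
  ∖⁺ S T Sv Tv = ⟦⟧⁺ (λ v → S v ≟ᵇ true ×-dec T v ≟ᵇ false) (Sv , Tv)

  piece? : (K : Subset n) (p q : Fin n) → ∀ v → Dec (K v ≡ true ⊎ v ≡ p ⊎ v ≡ q)
  piece? K p q v = K v ≟ᵇ true ⊎-dec v ≟ p ⊎-dec v ≟ q

  piece : Subset n → Fin n → Fin n → Subset n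
  piece K p q = ⟦ piece? K p q ⟧

-- Counting

count : ∀ {A : Set} → (A → Bool) → List A → ℕ
count f xs = sum (map (λ u → if f u then 1 else 0) xs)

module _ {A : Set} where

  count-mono : (f g : A → Bool) (xs : List A) → (∀ x → f x ≡ true → g x ≡ true) →
    count f xs ≤ count g xs
  count-mono f g [] f⊆g = z≤n
  count-mono f g (x ∷ xs) f⊆g with f x in fx | g x in gx
  ... | true  | true  = s≤s (count-mono f g xs f⊆g)
  ... | true  | false = contradiction gx (≡true⇒≢false (f⊆g x fx))
  ... | false | true  = m≤n⇒m≤1+n (count-mono f g xs f⊆g)
  ... | false | false = count-mono f g xs f⊆g

  count-mono-< : (f g : A → Bool) (xs : List A) → (∀ x → f x ≡ true → g x ≡ true) →
    ∀ {y} → y ∈ xs → f y ≡ false → g y ≡ true → count f xs < count g xs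
  count-mono-< f g (x ∷ xs) f⊆g (here refl) fy gy rewrite fy | gy = s≤s (count-mono f g xs f⊆g)
  count-mono-< f g (x ∷ xs) f⊆g (there y∈xs) fy gy with f x in fx | g x in gx
  ... | true  | true  = s≤s (count-mono-< f g xs f⊆g y∈xs fy gy)
  ... | true  | false = contradiction gx (≡true⇒≢false (f⊆g x fx))
  ... | false | true  = m≤n⇒m≤1+n (count-mono-< f g xs f⊆g y∈xs fy gy)
  ... | false | false = count-mono-< f g xs f⊆g y∈xs fy gy

  count-false : (xs : List A) → count (λ _ → false) xs ≡ 0
  count-false [] = refl
  count-false (_ ∷ xs) = count-false xs

  count≤length : (f : A → Bool) (xs : List A) → count f xs ≤ length xs
  count≤length f [] = z≤n
  count≤length f (x ∷ xs) with f x
  ... | true  = s≤s (count≤length f xs)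
  ... | false = m≤n⇒m≤1+n (count≤length f xs)

  count>0⇒∃ : (f : A → Bool) (xs : List A) → 0 < count f xs → ∃ λ x → x ∈ xs × f x ≡ true
  count>0⇒∃ f (x ∷ xs) pos with f x in fx
  ... | true  = x , here refl , fx
  ... | false with count>0⇒∃ f xs pos
  ...   | y , y∈xs , fy = y , there y∈xs , fy

  count-split : (f s : A → Bool) (xs : List A) →
    count f xs ≡ count (λ u → f u ∧ s u) xs + count (λ u → f u ∧ not (s u)) xs
  count-split f s [] = refl
  count-split f s (x ∷ xs) with f x | s x
  ... | true  | true  = cong suc (count-split f s xs)
  ... | true  | false = trans (cong suc (count-split f s xs)) (sym (+-suc _ _))
  ... | false | _     = count-split f s xs

  count-cong : (f g : A → Bool) (xs : List A) → (∀ x → f x ≡ g x) → count f xs ≡ count g xs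
  count-cong f g [] f≗g = refl
  count-cong f g (x ∷ xs) f≗g rewrite f≗g x =
    cong ((if g x then 1 else 0) +_) (count-cong f g xs f≗g)

  length-filter≡count : (f : A → Bool) (xs : List A) →
    length (filter (λ x → f x ≟ᵇ true) xs) ≡ count f xs
  length-filter≡count f [] = refl
  length-filter≡count f (x ∷ xs) with f x
  ... | true  = cong suc (length-filter≡count f xs)
  ... | false = length-filter≡count f xs

module _ {n : ℕ} where

  count≤n : (f : Fin n → Bool) → count f (allFin n) ≤ n
  count≤n f = ≤-trans (count≤length f (allFin n)) (≤-reflexive (length-tabulate id))

  size-< : (S T : Subset n) → S ⊆ T → ∀ v → S v ≡ false → T v ≡ true → size S < size T
  size-< S T S⊆T v Sv Tv = count-mono-< S T (allFin n) S⊆T (∈-allFin v) Sv Tv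

  size>0 : (S : Subset n) → ∀ v → S v ≡ true → 0 < size S
  size>0 S v Sv =
    subst (_< size S) (count-false (allFin n)) (size-< (λ _ → false) S (λ _ ()) v refl Sv)

  private
    count-without : (f : Fin n → Bool) (y : Fin n) (xs : List (Fin n)) → y ∉ xs →
      count (λ u → f u ∧ not ⌊ u ≟ y ⌋) xs ≡ count f xs
    count-without f y [] _ = refl
    count-without f y (x ∷ xs) y∉ with x ≟ y
    ... | yes refl = contradiction (here refl) y∉
    ... | no _ rewrite ∧-identityʳ (f x) =
      cong ((if f x then 1 else 0) +_) (count-without f y xs (λ m → y∉ (there m)))

    All≢⇒∉ : ∀ {y : Fin n} {xs} → All (y ≢_) xs → y ∉ xs
    All≢⇒∉ (y≢x ∷ _) (here refl) = y≢x refl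
    All≢⇒∉ (_ ∷ y≢xs) (there y∈) = All≢⇒∉ y≢xs y∈

    count-remove : (f : Fin n → Bool) (y : Fin n) (xs : List (Fin n)) → Unique xs →
      count f xs ≤ suc (count (λ u → f u ∧ not ⌊ u ≟ y ⌋) xs)
    count-remove f y [] _ = z≤n
    count-remove f y (x ∷ xs) (x∉xs ∷ unique) with x ≟ y
    ... | yes refl rewrite ∧-zeroʳ (f x) | count-without f x xs (All≢⇒∉ x∉xs) with f x
    ...   | true  = ≤-refl
    ...   | false = n≤1+n _
    count-remove f y (x ∷ xs) (_ ∷ unique) | no _ rewrite ∧-identityʳ (f x) with f x
    ...   | true  = s≤s (count-remove f y xs unique)
    ...   | false = count-remove f y xs unique

    count-avoiding : (f : Fin n → Bool) {k : ℕ} → suc k ≤ count f (allFin n) → ∀ y →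
      k ≤ count (λ u → f u ∧ not ⌊ u ≟ y ⌋) (allFin n)
    count-avoiding f k< y = s≤s⁻¹ (≤-trans k< (count-remove f y (allFin n) (allFin⁺ n)))

  ∃-avoiding₂ : (f : Fin n → Bool) → 3 ≤ count f (allFin n) → ∀ p q →
    ∃ λ x → f x ≡ true × x ≢ p × x ≢ q
  ∃-avoiding₂ f 3≤count p q
    with count>0⇒∃ _ (allFin n) (count-avoiding _ (count-avoiding f 3≤count p) q)
  ... | x , _ , fx = x , ∧-conicalˡ (f x) _ fx≢p ,
                      toWitnessFalse′ (x ≟ p) (∧-conicalʳ (f x) _ fx≢p) ,
                      toWitnessFalse′ (x ≟ q) (∧-conicalʳ (f x ∧ _) _ fx)
    where
    fx≢p : f x ∧ not ⌊ x ≟ p ⌋ ≡ true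
    fx≢p = ∧-conicalˡ (f x ∧ _) _ fx

Unique⇒length≤ : ∀ {xs ys : List ℕ} → Unique xs → (∀ {x} → x ∈ xs → x ∈ ys) →
  length xs ≤ length ys
Unique⇒length≤ {[]} _ _ = z≤n
Unique⇒length≤ {x ∷ xs} {ys} (x∉xs ∷ unique) xs⊆ys = ≤-trans
  (s≤s (Unique⇒length≤ unique λ y∈xs →
    ∈-filter⁺ (λ z → ¬? (x ≟ⁿ z)) (xs⊆ys (there y∈xs)) (All.lookup x∉xs y∈xs)))
  (filter-notAll (λ z → ¬? (x ≟ⁿ z)) ys (Any.map (λ x≡z x≢z → x≢z x≡z) (xs⊆ys (here refl))))

∃-∉ : ∀ {xs ys : List ℕ} → Unique xs → length ys < length xs → ∃ λ x → x ∈ xs × x ∉ ys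
∃-∉ {xs} {ys} unique longer with Any.any? (λ x → ¬? (x ∈? ys)) xs
... | yes new = find new
... | no none = contradiction
  (Unique⇒length≤ unique λ {x} x∈xs → decidable-stable (x ∈? ys) λ x∉ys →
    none (Any.map (λ { refl → x∉ys }) x∈xs))
  (<⇒≱ longer)

sort₃ : (P : ℕ → Set) → ∀ {x y z} → x ≢ y → x ≢ z → y ≢ z → P x → P y → P z →
  ∃ λ i → ∃ λ j → ∃ λ l → i < j × j < l × P i × P j × P l
sort₃ P {x} {y} {z} x≢y x≢z y≢z Px Py Pz with <-cmp x y | <-cmp x z | <-cmp y z
... | tri< x<y _ _ | tri< x<z _ _ | tri< y<z _ _ = x , y , z , x<y , y<z , Px , Py , Pz
... | tri< x<y _ _ | tri< x<z _ _ | tri> _ _ z<y = x , z , y , x<z , z<y , Px , Pz , Py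
... | tri< x<y _ _ | tri> _ _ z<x | _            = z , x , y , z<x , x<y , Pz , Px , Py
... | tri> _ _ y<x | tri< x<z _ _ | _            = y , x , z , y<x , x<z , Py , Px , Pz
... | tri> _ _ y<x | tri> _ _ z<x | tri< y<z _ _ = y , z , x , y<z , z<x , Py , Pz , Px
... | tri> _ _ y<x | tri> _ _ z<x | tri> _ _ z<y = z , y , x , z<y , y<x , Pz , Py , Px
... | tri≈ _ x≡y _ | _ | _ = contradiction x≡y x≢y
... | _ | tri≈ _ x≡z _ | _ = contradiction x≡z x≢z
... | _ | _ | tri≈ _ y≡z _ = contradiction y≡z y≢z

-- Graphs, paths and the added edge

Undirected : ∀ {n} → Graph n → Set
Undirected {n} H = ∀ (u v : Fin n) → H u v ≡ H v u

Simple⇒irreflexive : ∀ {n} {G : Graph n} → Simple G → ∀ {u v} → G u v ≡ true → u ≢ v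
Simple⇒irreflexive simple {u} e refl = contradiction (Simple.irrefl simple u) (≡true⇒≢false e)

module _ {n : ℕ} {H : Graph n} where

  _++ᵖ_ : ∀ {P u v w} → PathIn H P u v → PathIn H P v w → PathIn H P u w
  here ++ᵖ q = q
  step e pw p ++ᵖ q = step e pw (p ++ᵖ q)

  _∷ʳᵖ_ : ∀ {P u v w} → PathIn H P u v → H v w ≡ true × P w → PathIn H P u w
  p ∷ʳᵖ (e , pw) = p ++ᵖ step e pw here

  PathIn-reverse : Undirected H → ∀ {P u v} → P u → PathIn H P u v → PathIn H P v u
  PathIn-reverse sym-H pu here = here
  PathIn-reverse sym-H {u = u} pu (step {w = w} e pw p) =
    PathIn-reverse sym-H pw p ∷ʳᵖ (trans (sym-H w u) e , pu)

  PathIn-mapᴾ : ∀ {P Q : Fin n → Set} {u v} → (∀ x → P x → Q x) → PathIn H P u v → PathIn H Q u v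
  PathIn-mapᴾ P⊆Q here = here
  PathIn-mapᴾ P⊆Q (step e pw p) = step e (P⊆Q _ pw) (PathIn-mapᴾ P⊆Q p)

  connected-from : Undirected H → ∀ {P : Fin n → Set} r → P r → (∀ v → P v → PathIn H P r v) →
    Connected H P
  connected-from sym-H r pr path = (r , pr) , λ u v pu pv →
    PathIn-reverse sym-H pr (path u pu) ++ᵖ path v pv

PathIn-mapᴳ : ∀ {n} {H₁ H₂ : Graph n} {P : Fin n → Set} →
  (∀ u v → H₁ u v ≡ true → H₂ u v ≡ true) → ∀ {x y} → PathIn H₁ P x y → PathIn H₂ P x y
PathIn-mapᴳ H₁⊆H₂ here = here
PathIn-mapᴳ H₁⊆H₂ (step e pw p) = step (H₁⊆H₂ _ _ e) pw (PathIn-mapᴳ H₁⊆H₂ p)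

PathIn-bind : ∀ {n} {H₁ H₂ : Graph n} {P Q : Fin n → Set} →
  (∀ u w → P u → H₁ u w ≡ true → P w → PathIn H₂ Q u w) →
  ∀ {x y} → P x → PathIn H₁ P x y → PathIn H₂ Q x y
PathIn-bind edge px here = here
PathIn-bind edge px (step e pw p) = edge _ _ px e pw ++ᵖ PathIn-bind edge pw p

module _ {n : ℕ} (G : Graph n) (a b : Fin n) where

  addEdge-undirected : Undirected G → Undirected (addEdge G a b)
  addEdge-undirected sym-G x y = cong₂ _∨_ (sym-G x y) (begin
    (⌊ x ≟ a ⌋ ∧ ⌊ y ≟ b ⌋) ∨ (⌊ x ≟ b ⌋ ∧ ⌊ y ≟ a ⌋)
      ≡⟨ ∨-comm (⌊ x ≟ a ⌋ ∧ ⌊ y ≟ b ⌋) _ ⟩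
    (⌊ x ≟ b ⌋ ∧ ⌊ y ≟ a ⌋) ∨ (⌊ x ≟ a ⌋ ∧ ⌊ y ≟ b ⌋)
      ≡⟨ cong₂ _∨_ (∧-comm ⌊ x ≟ b ⌋ _) (∧-comm ⌊ x ≟ a ⌋ _) ⟩
    (⌊ y ≟ a ⌋ ∧ ⌊ x ≟ b ⌋) ∨ (⌊ y ≟ b ⌋ ∧ ⌊ x ≟ a ⌋) ∎)
    where open ≡-Reasoning

  addEdge⁺ : ∀ {u v} → G u v ≡ true → addEdge G a b u v ≡ true
  addEdge⁺ e rewrite e = refl

  addEdge-ab : addEdge G a b a b ≡ true
  addEdge-ab rewrite fromWitness′ (a ≟ a) refl | fromWitness′ (b ≟ b) refl = ∨-zeroʳ (G a b)

  addEdge⁻ : ∀ {u v} → addEdge G a b u v ≡ true →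
    G u v ≡ true ⊎ (u ≡ a × v ≡ b) ⊎ (u ≡ b × v ≡ a)
  addEdge⁻ {u} {v} e with G u v in uv | u ≟ a | v ≟ b | u ≟ b | v ≟ a
  ... | true  | _        | _        | _        | _        = inj₁ refl
  ... | false | yes refl | yes refl | _        | _        = inj₂ (inj₁ (refl , refl))
  ... | false | _        | _        | yes refl | yes refl = inj₂ (inj₂ (refl , refl))
  addEdge⁻ () | false | no _  | _    | no _  | _
  addEdge⁻ () | false | no _  | _    | yes _ | no _
  addEdge⁻ () | false | yes _ | no _ | no _  | _
  addEdge⁻ () | false | yes _ | no _ | yes _ | no _

module _ {n : ℕ} (G : Graph n) where

  degIn-mono : ∀ {S T : Subset n} w → (∀ u → G w u ≡ true → S u ≡ true → T u ≡ true) →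
    degIn G S w ≤ degIn G T w
  degIn-mono {S} {T} w S⇒T = count-mono _ _ (allFin n) λ u e →
    let Gwu = ∧-conicalˡ (G w u) (S u) e in ∧-intro Gwu (S⇒T u Gwu (∧-conicalʳ (G w u) (S u) e))

  neighbour-avoiding : ∀ (S : Subset n) w → 3 ≤ degIn G S w → ∀ p q →
    ∃ λ x → G w x ≡ true × S x ≡ true × x ≢ p × x ≢ q
  neighbour-avoiding S w 3≤deg p q with ∃-avoiding₂ (λ u → G w u ∧ S u) 3≤deg p q
  ... | x , e , x≢p , x≢q = x , ∧-conicalˡ (G w x) (S x) e , ∧-conicalʳ (G w x) (S x) e , x≢p , x≢q

  excess≡ : ∀ (S : Subset n) v →
    deg G v ∸ degIn G S v ≡ count (λ u → (G v u ∧ true) ∧ not (S u)) (allFin n)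
  excess≡ S v = begin
    deg G v ∸ degIn G S v               ≡⟨ cong (_∸ degIn G S v) (count-split _ S (allFin n)) ⟩
    inside + outside ∸ degIn G S v      ≡⟨ cong (λ k → k + outside ∸ degIn G S v) inside≡degIn ⟩
    degIn G S v + outside ∸ degIn G S v ≡⟨ m+n∸m≡n (degIn G S v) outside ⟩
    outside                             ∎
    where
    open ≡-Reasoning
    inside outside : ℕ
    inside = count (λ u → (G v u ∧ true) ∧ S u) (allFin n)
    outside = count (λ u → (G v u ∧ true) ∧ not (S u)) (allFin n)
    inside≡degIn : inside ≡ degIn G S v
    inside≡degIn = count-cong _ _ (allFin n) λ u → cong (_∧ S u) (∧-identityʳ (G v u))

-- Components

record Component {n : ℕ} (G : Graph n) (U : Subset n) (x : Fin n) (K : Subset n) : Set where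
  field
    root   : K x ≡ true
    ⊆U     : ∀ v → K v ≡ true → U v ≡ true
    path   : ∀ v → K v ≡ true → PathIn G (λ w → K w ≡ true) x v
    closed : ∀ u v → K u ≡ true → U v ≡ true → G u v ≡ true → K v ≡ true

module _ {n : ℕ} (G : Graph n) (U : Subset n) (x : Fin n) (Ux : U x ≡ true) where

  Expand : Subset n → Fin n → Set
  Expand R v = R v ≡ true ⊎ (U v ≡ true × ∃ λ z → R z ≡ true × G z v ≡ true)

  expand? : ∀ R v → Dec (Expand R v)
  expand? R v =
    R v ≟ᵇ true ⊎-dec (U v ≟ᵇ true ×-dec any? λ z → R z ≟ᵇ true ×-dec G z v ≟ᵇ true)

  -- the vertices joined to x by a walk of length at most k inside U
  reach : ℕ → Subset n
  reach zero = ⟦ _≟ x ⟧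
  reach (suc k) = ⟦ expand? (reach k) ⟧

  reach-suc : ∀ k v → reach k v ≡ true → reach (suc k) v ≡ true
  reach-suc k v r = ⟦⟧⁺ (expand? (reach k)) (inj₁ r)

  reach-root : ∀ k → reach k x ≡ true
  reach-root zero = ⟦⟧⁺ (_≟ x) refl
  reach-root (suc k) = reach-suc k x (reach-root k)

  reach⊆U : ∀ k v → reach k v ≡ true → U v ≡ true
  reach⊆U zero v r rewrite ⟦⟧⁻ (_≟ x) r = Ux
  reach⊆U (suc k) v r with ⟦⟧⁻ (expand? (reach k)) r
  ... | inj₁ r′ = reach⊆U k v r′
  ... | inj₂ (Uv , _) = Uv

  reach-path : ∀ k v → reach k v ≡ true → PathIn G (λ w → reach k w ≡ true) x v
  reach-path zero v r rewrite ⟦⟧⁻ (_≟ x) r = here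
  reach-path (suc k) v r with ⟦⟧⁻ (expand? (reach k)) r
  ... | inj₁ r′ = PathIn-mapᴾ (reach-suc k) (reach-path k v r′)
  ... | inj₂ (_ , z , rz , e) = PathIn-mapᴾ (reach-suc k) (reach-path k z rz) ∷ʳᵖ (e , r)

  Stable : ℕ → Set
  Stable k = ∀ v → reach (suc k) v ≡ true → reach k v ≡ true

  stable⇒closed : ∀ k → Stable k →
    ∀ u v → reach k u ≡ true → U v ≡ true → G u v ≡ true → reach k v ≡ true
  stable⇒closed k stable u v ru Uv e = stable v (⟦⟧⁺ (expand? (reach k)) (inj₂ (Uv , u , ru , e)))

  reach-grows : ∀ k → k < size (reach k) ⊎ ∃ Stable
  reach-grows zero = inj₁ (size>0 (reach zero) x (reach-root zero))
  reach-grows (suc k) with reach-grows k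
  ... | inj₂ stable = inj₂ stable
  ... | inj₁ k<size with any? (λ v → reach (suc k) v ≟ᵇ true ×-dec reach k v ≟ᵇ false)
  ...   | yes (v , new , old) =
    inj₁ (<-≤-trans (s≤s k<size) (size-< (reach k) (reach (suc k)) (reach-suc k) v old new))
  ...   | no none = inj₂ (k , λ v r → ¬-not λ old → none (v , r , old))

  -- reach k cannot keep growing beyond n vertices
  reach-stable : ∃ Stable
  reach-stable with reach-grows n
  ... | inj₁ n<size = contradiction (<-≤-trans n<size (count≤n _)) (<-irrefl refl)
  ... | inj₂ stable = stable

component : ∀ {n} (G : Graph n) (U : Subset n) x → U x ≡ true → Σ (Subset n) (Component G U x)
component G U x Ux with reach-stable G U x Ux
... | k , stable = reach G U x Ux k , record
  { root = reach-root G U x Ux k ; ⊆U = reach⊆U G U x Ux k ; path = reach-path G U x Ux k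
  ; closed = stable⇒closed G U x Ux k stable }

-- Walks

record Walk {n : ℕ} (H : Graph n) (U : Subset n) (x y : Fin n) (m : ℕ) : Set where
  field
    at       : ℕ → Fin n
    start    : at 0 ≡ x
    end      : at m ≡ y
    adjacent : ∀ t → t < m → H (at t) (at (suc t)) ≡ true
    interior : ∀ t → 0 < t → t < m → U (at t) ≡ true

open Walk

edge-walk : ∀ {n} {H : Graph n} {U : Subset n} {p q} → H p q ≡ true → Walk H U p q 1
edge-walk {p = p} {q} e = record
  { at = λ { zero → p ; (suc _) → q } ; start = refl ; end = refl
  ; adjacent = λ { zero _ → e ; (suc _) (s≤s ()) } ; interior = λ { (suc _) _ (s≤s ()) } }

walk-cons : ∀ {n} {H : Graph n} {U : Subset n} {x u y m} →
  H x u ≡ true → U u ≡ true → Walk H U u y m → Walk H U x y (suc m)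
walk-cons {n} {H} {U} {x} {m = m} e Uu w = record
  { at = at′ ; start = refl ; end = end w ; adjacent = adjacent′ ; interior = interior′ }
  where
  at′ : ℕ → Fin n
  at′ zero = x
  at′ (suc t) = at w t
  adjacent′ : ∀ t → t < suc m → H (at′ t) (at′ (suc t)) ≡ true
  adjacent′ zero _ = subst (λ v → H x v ≡ true) (sym (start w)) e
  adjacent′ (suc t) t<m = adjacent w t (s≤s⁻¹ t<m)
  interior′ : ∀ t → 0 < t → t < suc m → U (at′ t) ≡ true
  interior′ (suc zero) _ _ = subst (λ v → U v ≡ true) (sym (start w)) Uu
  interior′ (suc (suc t)) _ t<m = interior w (suc t) (s≤s z≤n) (s≤s⁻¹ t<m)

PathIn⇒Walk : ∀ {n} {G : Graph n} {K : Subset n} {u v} → PathIn G (λ w → K w ≡ true) u v →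
  K u ≡ true → ∀ {x y} → G x u ≡ true → G v y ≡ true → ∃ λ m → Walk G K x y (suc (suc m))
PathIn⇒Walk here Ku xu vy = 0 , walk-cons xu Ku (edge-walk vy)
PathIn⇒Walk (step e Kw p) Ku xu vy with PathIn⇒Walk p Kw e vy
... | m , w = suc m , walk-cons xu Ku w

module _ {n : ℕ} {H : Graph n} {U : Subset n} {x y : Fin n} {m : ℕ} (w : Walk H U x y m) where

  walk-path : (P : Fin n → Set) → ∀ {s} t → s ≤ t → t ≤ m →
    (∀ k → s < k → k ≤ t → P (at w k)) → PathIn H P (at w s) (at w t)
  walk-path P zero z≤n _ _ = here
  walk-path P (suc t) s≤t t≤m Pk with m≤n⇒m<n∨m≡n s≤t
  ... | inj₂ refl = here
  ... | inj₁ s<t =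
    walk-path P t (s≤s⁻¹ s<t) (<⇒≤ t≤m) (λ k s<k k≤t → Pk k s<k (m≤n⇒m≤1+n k≤t))
      ∷ʳᵖ (adjacent w t t≤m , Pk (suc t) s<t ≤-refl)

  sub-walk : {H′ : Graph n} {U′ : Subset n} → (∀ u v → H u v ≡ true → H′ u v ≡ true) →
    ∀ {s e} → s ≤ e → e ≤ m → (∀ t → s < t → t < e → U′ (at w t) ≡ true) →
    Walk H′ U′ (at w s) (at w e) (e ∸ s)
  sub-walk {H′} {U′} H⊆H′ {s} {e} s≤e e≤m U′-between = record
    { at = λ t → at w (s + t) ; start = cong (at w) (+-identityʳ s)
    ; end = cong (at w) (m+[n∸m]≡n s≤e) ; adjacent = adjacent′ ; interior = interior′ }
    where
    shift-< : ∀ {t} → t < e ∸ s → s + t < e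
    shift-< {t} t< = subst (s + t <_) (m+[n∸m]≡n s≤e) (+-monoʳ-< s t<)
    adjacent′ : ∀ t → t < e ∸ s → H′ (at w (s + t)) (at w (s + suc t)) ≡ true
    adjacent′ t t< rewrite +-suc s t = H⊆H′ _ _ (adjacent w (s + t) (<-≤-trans (shift-< t<) e≤m))
    interior′ : ∀ t → 0 < t → t < e ∸ s → U′ (at w (s + t)) ≡ true
    interior′ t 0<t t< =
      U′-between (s + t) (subst (_< s + t) (+-identityʳ s) (+-monoʳ-< s 0<t)) (shift-< t<)

  -- Drops the positions strictly between i and j.
  shortcut : ∀ {i j} → i < j → j ≤ m → H (at w i) (at w j) ≡ true →
    Walk H U x y (m ∸ (j ∸ suc i))
  shortcut {i} {j} i<j j≤m e = record
    { at = at′ ; start = start′ ; end = end′ ; adjacent = adjacent′ ; interior = interior′ }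
    where
    d : ℕ
    d = j ∸ suc i
    i+d+1≡j : suc (i + d) ≡ j
    i+d+1≡j = m+[n∸m]≡n i<j
    d≤m : d ≤ m
    d≤m = ≤-trans (m∸n≤m j (suc i)) j≤m
    shift-< : ∀ {t} → t < m ∸ d → t + d < m
    shift-< t< = m≤o∸n⇒m+n≤o (suc _) d≤m t<
    i<m : i < m
    i<m = <-≤-trans i<j j≤m
    i<m∸d : i < m ∸ d
    i<m∸d = m+n≤o⇒m≤o∸n (suc i) (subst (_≤ m) (sym i+d+1≡j) j≤m)
    at′ : ℕ → Fin n
    at′ t with t ≤? i
    ... | yes _ = at w t
    ... | no _ = at w (t + d)
    start′ : at′ 0 ≡ x
    start′ with 0 ≤? i
    ... | yes _ = start w
    ... | no 0≰i = contradiction z≤n 0≰i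
    end′ : at′ (m ∸ d) ≡ y
    end′ with (m ∸ d) ≤? i
    ... | yes m∸d≤i = contradiction m∸d≤i (<⇒≱ i<m∸d)
    ... | no _ rewrite m∸n+n≡m d≤m = end w
    adjacent′ : ∀ t → t < m ∸ d → H (at′ t) (at′ (suc t)) ≡ true
    adjacent′ t t< with t ≤? i | suc t ≤? i
    ... | yes t≤i | yes t<i = adjacent w t (≤-<-trans t≤i i<m)
    ... | yes t≤i | no t≮i with m≤n⇒m<n∨m≡n t≤i
    ...   | inj₁ t<i = contradiction t<i t≮i
    ...   | inj₂ refl = subst (λ v → H (at w i) v ≡ true) (cong (at w) (sym i+d+1≡j)) e
    adjacent′ t t< | no t≰i | yes t<i = contradiction (<⇒≤ t<i) t≰i
    adjacent′ t t< | no _ | no _ = adjacent w (t + d) (shift-< t<)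
    interior′ : ∀ t → 0 < t → t < m ∸ d → U (at′ t) ≡ true
    interior′ t 0<t t< with t ≤? i
    ... | yes t≤i = interior w t 0<t (≤-<-trans t≤i i<m)
    ... | no _ = interior w (t + d) (<-≤-trans 0<t (m≤m+n t d)) (shift-< t<)

shortcut-length : ∀ {i j m} → 0 < i → suc i < j → j ≤ m →
  2 ≤ m ∸ (j ∸ suc i) × m ∸ (j ∸ suc i) < m
shortcut-length {i} {j} {m} 0<i i+1<j j≤m =
  m+n≤o⇒m≤o∸n 2 (≤-trans (+-monoˡ-≤ (j ∸ suc i) (s≤s 0<i))
                          (≤-trans (≤-reflexive (m+[n∸m]≡n (<⇒≤ i+1<j))) j≤m)) ,
  ∸-monoʳ-< (m<n⇒0<n∸m i+1<j) (≤-trans (m∸n≤m j (suc i)) j≤m)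

record ShortcutFree {n : ℕ} (G : Graph n) (U : Subset n) (a b : Fin n) : Set where
  field
    len      : ℕ
    walk     : Walk G U a b len
    2≤len    : 2 ≤ len
    distinct : ∀ i j → i < j → j ≤ len → at walk i ≢ at walk j
    chords   : ∀ j → j ≤ len → G (at walk 1) (at walk j) ≡ true → j ≡ 0 ⊎ j ≡ 2

-- Repeatedly shortcut a repeated vertex or a chord from the first inner vertex.
module _ {n : ℕ} (G : Graph n) (simple : Simple G) (U : Subset n) {a b : Fin n}
  (Ua : U a ≡ false) (Ub : U b ≡ false) (a≢b : a ≢ b) where

  shortcut-free : ∀ {m} → 2 ≤ m → Walk G U a b m → ShortcutFree G U a b
  shortcut-free {m} = go m ≤-refl
    where
    go : ∀ fuel {m} → m ≤ fuel → 2 ≤ m → Walk G U a b m → ShortcutFree G U a b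
    go zero m≤0 2≤m w = contradiction (≤-trans 2≤m m≤0) λ ()
    go (suc fuel) {m} m≤fuel 2≤m w
      with anyUpTo? (λ j → anyUpTo? (λ i → at w i ≟ at w j) j) (suc m)
    ... | yes (j , j<m+1 , i , i<j , same) = go fuel (s≤s⁻¹ (<-≤-trans shorter m≤fuel)) longer
                                                (shortcut w (m≤n⇒m≤1+n i<j) j<m edge)
      where
      j≤m : j ≤ m
      j≤m = s≤s⁻¹ j<m+1
      -- a repetition cannot involve the ends, which lie outside U
      repeat-interior : ∀ {k} → k < j → at w k ≡ at w j → 0 < k
      repeat-interior {suc _} _ _ = s≤s z≤n
      repeat-interior {zero} 0<j a≡ with m≤n⇒m<n∨m≡n j≤m
      ... | inj₂ refl = contradiction (trans (sym (start w)) (trans a≡ (end w))) a≢b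
      ... | inj₁ j<m = contradiction (trans (cong U (trans (sym a≡) (start w))) Ua)
                                     (≡true⇒≢false (interior w j 0<j j<m))
      0<i : 0 < i
      0<i = repeat-interior i<j same
      j<m : j < m
      j<m with m≤n⇒m<n∨m≡n j≤m
      ... | inj₁ j<m = j<m
      ... | inj₂ refl = contradiction (trans (cong U (trans same (end w))) Ub)
                                      (≡true⇒≢false (interior w i 0<i i<j))
      edge : G (at w i) (at w (suc j)) ≡ true
      edge rewrite same = adjacent w j j<m
      longer : 2 ≤ m ∸ (suc j ∸ suc i)
      longer = proj₁ (shortcut-length 0<i (s≤s i<j) j<m)
      shorter : m ∸ (suc j ∸ suc i) < m
      shorter = proj₂ (shortcut-length 0<i (s≤s i<j) j<m)
    ... | no no-repeat with anyUpTo? (λ j → 3 ≤? j ×-dec G (at w 1) (at w j) ≟ᵇ true) (suc m)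
    ...   | yes (j , j<m+1 , 3≤j , chord) = go fuel (s≤s⁻¹ (<-≤-trans shorter m≤fuel)) longer
                                              (shortcut w (≤-trans (n≤1+n 2) 3≤j) (s≤s⁻¹ j<m+1) chord)
      where
      longer : 2 ≤ m ∸ (j ∸ 2)
      longer = proj₁ (shortcut-length (s≤s z≤n) 3≤j (s≤s⁻¹ j<m+1))
      shorter : m ∸ (j ∸ 2) < m
      shorter = proj₂ (shortcut-length (s≤s z≤n) 3≤j (s≤s⁻¹ j<m+1))
    ...   | no no-chord = record
      { len = m ; walk = w ; 2≤len = 2≤m
      ; distinct = λ i j i<j j≤m same → no-repeat (j , s≤s j≤m , i , i<j , same)
      ; chords = chords }
      where
      chords : ∀ j → j ≤ m → G (at w 1) (at w j) ≡ true → j ≡ 0 ⊎ j ≡ 2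
      chords 0 _ _ = inj₁ refl
      chords 1 _ loop = contradiction refl (Simple⇒irreflexive simple loop)
      chords 2 _ _ = inj₂ refl
      chords (suc (suc (suc k))) j≤m chord =
        contradiction (suc (suc (suc k)) , s≤s j≤m , s≤s (s≤s (s≤s z≤n)) , chord) no-chord

-- Rooted K4 minors

K4MinorIn : ∀ {n} → Graph n → Subset n → Set
K4MinorIn H V = Σ (HasK4Minor H) λ model → ∀ v i → proj₁ model v ≡ just i → V v ≡ true

Joined : ∀ {n} → Graph n → (Fin n → Maybe (Fin 4)) → Fin 4 → Fin 4 → Set
Joined H β i j = ∃ λ u → ∃ λ v → β u ≡ just i × β v ≡ just j × H u v ≡ true

Joined-flip : ∀ {n} {H : Graph n} {β} → Undirected H → ∀ {i j} → Joined H β i j → Joined H β j i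
Joined-flip sym-H (u , v , βu , βv , e) = v , u , βv , βu , trans (sym-H v u) e

Between : ∀ {n} → (ℕ → Fin n) → ℕ → ℕ → Fin n → Set
Between c lo hi v = ∃ λ t → t < hi × lo ≤ t × c t ≡ v

between? : ∀ {n} (c : ℕ → Fin n) lo hi v → Dec (Between c lo hi v)
between? c lo hi v = anyUpTo? (λ t → lo ≤? t ×-dec c t ≟ v) hi

-- The inner vertices of the link join the branch set of p, which then absorbs the edge pq.
module Lift {n : ℕ} (G : Graph n) (simple : Simple G) (a b : Fin n)
  {V V′ : Subset n} (V′⊆V : V′ ⊆ V)
  {p q : Fin n} {r : ℕ} (link : Walk (addEdge G a b) (V ∖ V′) p q (suc r)) where

  private
    H : Graph n
    H = addEdge G a b

    H-undirected : Undirected H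
    H-undirected = addEdge-undirected G a b (Simple.sym simple)

    inner : Subset n
    inner = ⟦ between? (at link) 1 (suc r) ⟧

    inner⇒∖ : ∀ v → inner v ≡ true → (V ∖ V′) v ≡ true
    inner⇒∖ v in-v with ⟦⟧⁻ (between? (at link) 1 (suc r)) in-v
    ... | t , t<r , 0<t , refl = interior link t 0<t t<r

    inner-at : ∀ t → 0 < t → t < suc r → inner (at link t) ≡ true
    inner-at t 0<t t<r = ⟦⟧⁺ (between? (at link) 1 (suc r)) (t , t<r , 0<t , refl)

    last-edge : H (at link r) q ≡ true
    last-edge = subst (λ v → H (at link r) v ≡ true) (end link) (adjacent link r ≤-refl)

  lifted : K4MinorIn (addEdge G p q) V′ → K4MinorIn (addEdge G a b) V
  lifted ((β′ , connected′ , joined′) , β′⊆V′) = (β , connected , joined) , β⊆V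
    where
    β : Fin n → Maybe (Fin 4)
    β v = if inner v then β′ p else β′ v

    Branch : Fin 4 → Fin n → Set
    Branch i v = β v ≡ just i

    β-old : ∀ {v i} → β′ v ≡ just i → Branch i v
    β-old {v} β′v with inner v in in-v
    ... | false = β′v
    ... | true = contradiction (proj₂ (∖⁻ V V′ (inner⇒∖ v in-v)))
                               (≡true⇒≢false (β′⊆V′ v _ β′v))

    β-link : ∀ {i} → β′ p ≡ just i → ∀ t → t ≤ r → Branch i (at link t)
    β-link β′p zero _ = subst (Branch _) (sym (start link)) (β-old β′p)
    β-link β′p (suc t) t<r rewrite inner-at (suc t) (s≤s z≤n) (s≤s t<r) = β′p

    along : ∀ {i} → β′ p ≡ just i → ∀ t → t ≤ r → PathIn H (Branch i) p (at link t)
    along β′p t t≤r = subst (λ v → PathIn H (Branch _) v (at link t)) (start link)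
      (walk-path link (Branch _) t z≤n (m≤n⇒m≤1+n t≤r) λ k _ k≤t →
        β-link β′p k (≤-trans k≤t t≤r))

    across : ∀ {i} → β′ p ≡ just i → β′ q ≡ just i → PathIn H (Branch i) p q
    across β′p β′q = along β′p r ≤-refl ∷ʳᵖ (last-edge , β-old β′q)

    connected : ∀ i → Connected H (Branch i)
    connected i = connected-from H-undirected r₀ (β-old β′r₀) path-to
      where
      r₀ : Fin n
      r₀ = proj₁ (proj₁ (connected′ i))
      β′r₀ : β′ r₀ ≡ just i
      β′r₀ = proj₂ (proj₁ (connected′ i))
      edge : ∀ u w → β′ u ≡ just i → addEdge G p q u w ≡ true → β′ w ≡ just i →
        PathIn H (Branch i) u w
      edge u w β′u e β′w with addEdge⁻ G p q e
      ... | inj₁ e′ = step (addEdge⁺ G a b e′) (β-old β′w) here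
      ... | inj₂ (inj₁ (refl , refl)) = across β′u β′w
      ... | inj₂ (inj₂ (refl , refl)) = PathIn-reverse H-undirected (β-old β′w) (across β′w β′u)
      old : ∀ v → β′ v ≡ just i → PathIn H (Branch i) r₀ v
      old v β′v = PathIn-bind edge β′r₀ (proj₂ (connected′ i) r₀ v β′r₀ β′v)
      path-to : ∀ v → Branch i v → PathIn H (Branch i) r₀ v
      path-to v βv with inner v in in-v
      ... | false = old v βv
      ... | true with ⟦⟧⁻ (between? (at link) 1 (suc r)) in-v
      ...   | t , t<r , _ , refl = old p βv ++ᵖ along βv t (s≤s⁻¹ t<r)

    joined : ∀ i j → i ≢ j → Joined H β i j
    joined i j i≢j with joined′ i j i≢j
    ... | u , v , β′u , β′v , e with addEdge⁻ G p q e
    ...   | inj₁ e′ = u , v , β-old β′u , β-old β′v , addEdge⁺ G a b e′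
    ...   | inj₂ (inj₁ (refl , refl)) = at link r , q , β-link β′u r ≤-refl , β-old β′v , last-edge
    ...   | inj₂ (inj₂ (refl , refl)) =
      Joined-flip H-undirected (at link r , q , β-link β′v r ≤-refl , β-old β′u , last-edge)

    β⊆V : ∀ v i → β v ≡ just i → V v ≡ true
    β⊆V v i βv with inner v in in-v
    ... | true = proj₁ (∖⁻ V V′ (inner⇒∖ v in-v))
    ... | false = V′⊆V v (β′⊆V′ v i βv)

Attached : ∀ {n} → Graph n → Subset n → Fin n → Set
Attached G K v = ∃ λ y → K y ≡ true × G y v ≡ true

-- Branch sets: K and the three arcs of the path cut after positions i and j; K reaches each arc at
-- an attachment, consecutive arcs are joined along the path, and ab joins the first arc to the last.
module ThreeAttachments {n : ℕ} (G : Graph n) (simple : Simple G) {a b : Fin n} (V : Subset n)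
  {U : Subset n} {m : ℕ} (w : Walk G U a b m)
  (distinct : ∀ s t → s < t → t ≤ m → at w s ≢ at w t)
  (on-V : ∀ t → t ≤ m → V (at w t) ≡ true)
  {K : Subset n} (K⊆V : K ⊆ V) (K-off : ∀ t → t ≤ m → K (at w t) ≡ false)
  (K-connected : Connected G (λ v → K v ≡ true))
  {i j l : ℕ} (i<j : i < j) (j<l : j < l) (l≤m : l ≤ m)
  (att-i : Attached G K (at w i)) (att-j : Attached G K (at w j)) (att-l : Attached G K (at w l)) where

  private
    H : Graph n
    H = addEdge G a b

    H-undirected : Undirected H
    H-undirected = addEdge-undirected G a b (Simple.sym simple)

    G⊆H : ∀ u v → G u v ≡ true → H u v ≡ true
    G⊆H u v = addEdge⁺ G a b

    j<m : j < m
    j<m = <-≤-trans j<l l≤m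

    j≤m : j ≤ m
    j≤m = <⇒≤ j<m

    arc : ℕ → Fin 3
    arc t with t ≤? i | t ≤? j
    ... | yes _ | _ = 0F
    ... | no _ | yes _ = 1F
    ... | no _ | no _ = 2F

    first last : Fin 3 → ℕ
    first 0F = 0
    first 1F = suc i
    first 2F = suc j
    last 0F = i
    last 1F = j
    last 2F = m

    first≤last : ∀ k → first k ≤ last k
    first≤last 0F = z≤n
    first≤last 1F = i<j
    first≤last 2F = j<m

    last≤m : ∀ k → last k ≤ m
    last≤m 0F = ≤-trans (<⇒≤ i<j) j≤m
    last≤m 1F = j≤m
    last≤m 2F = ≤-refl

    arc⁻ : ∀ t → t ≤ m → first (arc t) ≤ t × t ≤ last (arc t)
    arc⁻ t t≤m with t ≤? i | t ≤? j
    ... | yes t≤i | _ = z≤n , t≤i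
    ... | no t≰i | yes t≤j = ≰⇒> t≰i , t≤j
    ... | no _ | no t≰j = ≰⇒> t≰j , t≤m

    arc⁺ : ∀ k t → first k ≤ t → t ≤ last k → arc t ≡ k
    arc⁺ k t lo≤t t≤hi with t ≤? i | t ≤? j | k
    ... | yes _   | _       | 0F = refl
    ... | yes t≤i | _       | 1F = contradiction t≤i (<⇒≱ lo≤t)
    ... | yes t≤i | _       | 2F = contradiction t≤i (<⇒≱ (<-trans i<j lo≤t))
    ... | no t≰i  | _       | 0F = contradiction t≤hi t≰i
    ... | no _    | yes _   | 1F = refl
    ... | no _    | yes t≤j | 2F = contradiction t≤j (<⇒≱ lo≤t)
    ... | no _    | no t≰j  | 1F = contradiction t≤hi t≰j
    ... | no _    | no _    | 2F = refl

    β : Fin n → Maybe (Fin 4)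
    β v with K v | between? (at w) 0 (suc m) v
    ... | true  | _           = just 0F
    ... | false | yes (t , _) = just (fsuc (arc t))
    ... | false | no _        = nothing

    Branch : Fin 4 → Fin n → Set
    Branch k v = β v ≡ just k

    position-unique : ∀ {s t} → s ≤ m → t ≤ m → at w s ≡ at w t → s ≡ t
    position-unique {s} {t} s≤m t≤m same with <-cmp s t
    ... | tri< s<t _ _ = contradiction same (distinct s t s<t t≤m)
    ... | tri≈ _ s≡t _ = s≡t
    ... | tri> _ _ t<s = contradiction (sym same) (distinct t s t<s s≤m)

    β-walk : ∀ t → t ≤ m → Branch (fsuc (arc t)) (at w t)
    β-walk t t≤m with K (at w t) in Kt | between? (at w) 0 (suc m) (at w t)
    ... | true | _ = contradiction (K-off t t≤m) (≡true⇒≢false Kt)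
    ... | false | yes (s , s<m+1 , _ , same) =
      cong (λ s → just (fsuc (arc s))) (position-unique (s≤s⁻¹ s<m+1) t≤m same)
    ... | false | no off = contradiction (t , s≤s t≤m , z≤n , refl) off

    β-arc : ∀ k t → first k ≤ t → t ≤ last k → Branch (fsuc k) (at w t)
    β-arc k t lo≤t t≤hi = subst (λ k′ → Branch (fsuc k′) (at w t)) (arc⁺ k t lo≤t t≤hi)
                                (β-walk t (≤-trans t≤hi (last≤m k)))

    β-K : ∀ v → K v ≡ true → Branch 0F v
    β-K v Kv rewrite Kv = refl

    β⁻ : ∀ v k → Branch k v →
      (K v ≡ true × k ≡ 0F) ⊎ ∃ λ t → t ≤ m × at w t ≡ v × fsuc (arc t) ≡ k
    β⁻ v k βv with K v | between? (at w) 0 (suc m) v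
    ... | true | _ = inj₁ (refl , sym (just-injective βv))
    ... | false | yes (t , t<m+1 , _ , at-t) = inj₂ (t , s≤s⁻¹ t<m+1 , at-t , just-injective βv)

    arc-connected : ∀ k → Connected H (Branch (fsuc k))
    arc-connected k =
      connected-from H-undirected (at w (first k)) (β-arc k _ ≤-refl (first≤last k)) path-to
      where
      path-to : ∀ v → Branch (fsuc k) v → PathIn H (Branch (fsuc k)) (at w (first k)) v
      path-to v βv with β⁻ v (fsuc k) βv
      ... | inj₁ (_ , ())
      ... | inj₂ (t , t≤m , refl , refl) = PathIn-mapᴳ G⊆H
        (walk-path w (Branch (fsuc (arc t))) t (proj₁ (arc⁻ t t≤m)) t≤m λ s lo<s s≤t →
          β-arc (arc t) s (<⇒≤ lo<s) (≤-trans s≤t (proj₂ (arc⁻ t t≤m))))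

    K-connected′ : Connected H (Branch 0F)
    K-connected′ = (r₀ , β-K r₀ Kr₀) , λ u v βu βv →
      PathIn-mapᴾ β-K (PathIn-mapᴳ G⊆H (proj₂ K-connected u v (K-of u βu) (K-of v βv)))
      where
      r₀ : Fin n
      r₀ = proj₁ (proj₁ K-connected)
      Kr₀ : K r₀ ≡ true
      Kr₀ = proj₂ (proj₁ K-connected)
      K-of : ∀ v → Branch 0F v → K v ≡ true
      K-of v βv with β⁻ v 0F βv
      ... | inj₁ (Kv , _) = Kv

    connected : ∀ k → Connected H (Branch k)
    connected 0F = K-connected′
    connected (fsuc k) = arc-connected k

    K-to : ∀ {t} k → Attached G K (at w t) → first k ≤ t → t ≤ last k → Joined H β 0F (fsuc k)
    K-to k (y , Ky , e) lo≤t t≤hi = y , _ , β-K y Ky , β-arc k _ lo≤t t≤hi , G⊆H _ _ e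

    joined : ∀ x y → x ≢ y → Joined H β x y
    joined 0F 0F 0≢0 = contradiction refl 0≢0
    joined 0F 1F _ = K-to 0F att-i z≤n ≤-refl
    joined 0F 2F _ = K-to 1F att-j i<j ≤-refl
    joined 0F 3F _ = K-to 2F att-l j<l l≤m
    joined 1F 0F _ = Joined-flip H-undirected (joined 0F 1F λ ())
    joined 1F 1F 1≢1 = contradiction refl 1≢1
    joined 1F 2F _ = at w i , at w (suc i) , β-arc 0F i z≤n ≤-refl , β-arc 1F (suc i) ≤-refl i<j ,
                     G⊆H _ _ (adjacent w i (<-≤-trans i<j j≤m))
    joined 1F 3F _ = at w 0 , at w m , β-arc 0F 0 z≤n z≤n , β-arc 2F m j<m ≤-refl ,
                     subst₂ (λ u v → H u v ≡ true) (sym (start w)) (sym (end w)) (addEdge-ab G a b)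
    joined 2F 0F _ = Joined-flip H-undirected (joined 0F 2F λ ())
    joined 2F 1F _ = Joined-flip H-undirected (joined 1F 2F λ ())
    joined 2F 2F 2≢2 = contradiction refl 2≢2
    joined 2F 3F _ = at w j , at w (suc j) , β-arc 1F j i<j ≤-refl , β-arc 2F (suc j) ≤-refl j<m ,
                     G⊆H _ _ (adjacent w j j<m)
    joined 3F 0F _ = Joined-flip H-undirected (joined 0F 3F λ ())
    joined 3F 1F _ = Joined-flip H-undirected (joined 1F 3F λ ())
    joined 3F 2F _ = Joined-flip H-undirected (joined 2F 3F λ ())
    joined 3F 3F 3≢3 = contradiction refl 3≢3

    β⊆V : ∀ v k → β v ≡ just k → V v ≡ true
    β⊆V v k βv with β⁻ v k βv
    ... | inj₁ (Kv , _) = K⊆V v Kv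
    ... | inj₂ (t , t≤m , refl , _) = on-V t t≤m

  minor : K4MinorIn (addEdge G a b) V
  minor = (β , connected , joined) , β⊆V

-- The rooted Dirac theorem

record Rooted3 {n : ℕ} (G : Graph n) (V : Subset n) (a b : Fin n) : Set where
  field
    a≢b   : a ≢ b
    a∈V   : V a ≡ true
    b∈V   : V b ≡ true
    inner : ∃ λ w → V w ≡ true × w ≢ a × w ≢ b
    deg≥3 : ∀ w → V w ≡ true → w ≢ a → w ≢ b → 3 ≤ degIn G V w

module Induction {n : ℕ} (G : Graph n) (simple : Simple G) where

  Claim : ℕ → Set
  Claim f = ∀ {V a b} → size V ≤ f → Rooted3 G V a b → K4MinorIn (addEdge G a b) V

  module Step {f : ℕ} (IH : Claim f) {V : Subset n} {a b : Fin n} (size≤ : size V ≤ suc f)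
    (R : Rooted3 G V a b) where

    open Rooted3 R

    H : Graph n
    H = addEdge G a b

    NonRoot : Fin n → Set
    NonRoot v = V v ≡ true × v ≢ a × v ≢ b

    nonRoot? : ∀ v → Dec (NonRoot v)
    nonRoot? v = V v ≟ᵇ true ×-dec ¬? (v ≟ a) ×-dec ¬? (v ≟ b)

    roots∉ : ∀ {U : Subset n} → (∀ v → U v ≡ true → NonRoot v) → U a ≡ false × U b ≡ false
    roots∉ U-nonRoot = ¬-not (λ Ua → proj₁ (proj₂ (U-nonRoot a Ua)) refl) ,
                       ¬-not (λ Ub → proj₂ (proj₂ (U-nonRoot b Ub)) refl)

    CutOff : Subset n → Subset n → Fin n → Fin n → Set
    CutOff U K p q =
      ∀ k u → K k ≡ true → V u ≡ true → G k u ≡ true → U u ≡ false → u ≡ p ⊎ u ≡ q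

    module Piece {U : Subset n} (U-nonRoot : ∀ v → U v ≡ true → NonRoot v)
      {x : Fin n} {K : Subset n} (comp : Component G U x K)
      {p q : Fin n} (p∈V : V p ≡ true) (q∈V : V q ≡ true) (attach : CutOff U K p q) where

      open Component comp

      private
        K-nonRoot : ∀ {v} → K v ≡ true → NonRoot v
        K-nonRoot {v} Kv = U-nonRoot v (⊆U v Kv)

        K⊆piece : ∀ {v} → K v ≡ true → piece K p q v ≡ true
        K⊆piece Kv = ⟦⟧⁺ (piece? K p q) (inj₁ Kv)

        p∈piece : piece K p q p ≡ true
        p∈piece = ⟦⟧⁺ (piece? K p q) (inj₂ (inj₁ refl))

        q∈piece : piece K p q q ≡ true
        q∈piece = ⟦⟧⁺ (piece? K p q) (inj₂ (inj₂ refl))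

        neighbour∈piece : ∀ k u → K k ≡ true → G k u ≡ true → V u ≡ true → piece K p q u ≡ true
        neighbour∈piece k u Kk e Vu with U u in Uu
        ... | true = K⊆piece (closed k u Kk Uu e)
        ... | false with attach k u Kk Vu e Uu
        ...   | inj₁ refl = p∈piece
        ...   | inj₂ refl = q∈piece

      piece⊆V : piece K p q ⊆ V
      piece⊆V v e with ⟦⟧⁻ (piece? K p q) e
      ... | inj₁ Kv = proj₁ (K-nonRoot Kv)
      ... | inj₂ (inj₁ refl) = p∈V
      ... | inj₂ (inj₂ refl) = q∈V

      piece-smaller : ∀ {s} → V s ≡ true → K s ≡ false → s ≢ p → s ≢ q → size (piece K p q) ≤ f
      piece-smaller {s} s∈V Ks s≢p s≢q =
        s≤s⁻¹ (<-≤-trans (size-< (piece K p q) V piece⊆V s s∉piece s∈V) size≤)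
        where
        s∉piece : piece K p q s ≡ false
        s∉piece = ⟦⟧-false (piece? K p q) λ
          { (inj₁ Ks′) → contradiction Ks (≡true⇒≢false Ks′)
          ; (inj₂ (inj₁ s≡p)) → s≢p s≡p
          ; (inj₂ (inj₂ s≡q)) → s≢q s≡q }

      piece-rooted : p ≢ q → Rooted3 G (piece K p q) p q
      piece-rooted p≢q = record
        { a≢b = p≢q ; a∈V = p∈piece ; b∈V = q∈piece ; inner = inner′ ; deg≥3 = deg≥3′ }
        where
        deg≥3′ : ∀ w → piece K p q w ≡ true → w ≢ p → w ≢ q → 3 ≤ degIn G (piece K p q) w
        deg≥3′ w e w≢p w≢q with ⟦⟧⁻ (piece? K p q) e
        ... | inj₂ (inj₁ w≡p) = contradiction w≡p w≢p
        ... | inj₂ (inj₂ w≡q) = contradiction w≡q w≢q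
        ... | inj₁ Kw with K-nonRoot Kw
        ...   | Vw , w≢a , w≢b =
          ≤-trans (deg≥3 w Vw w≢a w≢b) (degIn-mono G w λ u e Vu → neighbour∈piece w u Kw e Vu)
        inner′ : ∃ λ w → piece K p q w ≡ true × w ≢ p × w ≢ q
        inner′ with K-nonRoot root
        ... | Vx , x≢a , x≢b with neighbour-avoiding G V x (deg≥3 x Vx x≢a x≢b) p q
        ...   | y , e , Vy , y≢p , y≢q = y , neighbour∈piece x y root e Vy , y≢p , y≢q

    -- K ∪ {p, q} with roots p, q is a smaller instance (s is left out); its K4 minor lifts along
    -- the link from p to q.
    reduce : ∀ {U : Subset n} → (∀ v → U v ≡ true → NonRoot v) → ∀ {x K} → Component G U x K →
      ∀ {p q} → V p ≡ true → V q ≡ true → p ≢ q → CutOff U K p q →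
      ∀ {s} → V s ≡ true → K s ≡ false → s ≢ p → s ≢ q →
      ∀ {r} → Walk H (V ∖ piece K p q) p q (suc r) → K4MinorIn H V
    reduce U-nonRoot comp p∈V q∈V p≢q attach s∈V Ks s≢p s≢q link =
      Lift.lifted G simple a b piece⊆V link (IH (piece-smaller s∈V Ks s≢p s≢q) (piece-rooted p≢q))
      where open Piece U-nonRoot comp p∈V q∈V attach

    -- The inner vertex c 1 has a neighbour x₀ off the path. The component K₂ of x₀ off the path
    -- either attaches to three positions of the path, giving the K4 directly, or to 1 and at most
    -- one other position j, in which case it is cut off by c 1 and c j.
    module ViaPath {U : Subset n} (U-nonRoot : ∀ v → U v ≡ true → NonRoot v)
      (P : ShortcutFree G U a b) where

      open ShortcutFree P renaming (len to m)

      c : ℕ → Fin n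
      c = at walk

      1≤m : 1 ≤ m
      1≤m = <⇒≤ 2≤len

      on-V : ∀ t → t ≤ m → V (c t) ≡ true
      on-V zero _ = subst (λ v → V v ≡ true) (sym (start walk)) a∈V
      on-V (suc t) t<m+1 with m≤n⇒m<n∨m≡n t<m+1
      ... | inj₁ t<m = proj₁ (U-nonRoot _ (interior walk (suc t) (s≤s z≤n) t<m))
      ... | inj₂ refl = subst (λ v → V v ≡ true) (sym (end walk)) b∈V

      positions-differ : ∀ {s t} → s ≢ t → s ≤ m → t ≤ m → c s ≢ c t
      positions-differ {s} {t} s≢t s≤m t≤m with <-cmp s t
      ... | tri< s<t _ _ = distinct s t s<t t≤m
      ... | tri≈ _ s≡t _ = contradiction s≡t s≢t
      ... | tri> _ _ t<s = λ same → distinct t s t<s s≤m (sym same)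

      OnPath : Fin n → Set
      OnPath = Between c 0 (suc m)

      onPath : ∀ t → t ≤ m → OnPath (c t)
      onPath t t≤m = t , s≤s t≤m , z≤n , refl

      x₀-exists : ∃ λ x → G (c 1) x ≡ true × V x ≡ true × ¬ OnPath x
      x₀-exists with U-nonRoot (c 1) (interior walk 1 (s≤s z≤n) 2≤len)
      ... | V₁ , c₁≢a , c₁≢b
        with neighbour-avoiding G V (c 1) (deg≥3 (c 1) V₁ c₁≢a c₁≢b) (c 0) (c 2)
      ...   | x , e , Vx , x≢c₀ , x≢c₂ = x , e , Vx , off
        where
        off : ¬ OnPath x
        off (t , t<m+1 , _ , ct≡x)
          with chords t (s≤s⁻¹ t<m+1) (subst (λ v → G (c 1) v ≡ true) (sym ct≡x) e)
        ... | inj₁ refl = x≢c₀ (sym ct≡x)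
        ... | inj₂ refl = x≢c₂ (sym ct≡x)

      x₀ : Fin n
      x₀ = proj₁ x₀-exists

      off? : ∀ v → Dec (V v ≡ true × ¬ OnPath v)
      off? v = V v ≟ᵇ true ×-dec ¬? (between? c 0 (suc m) v)

      Off : Subset n
      Off = ⟦ off? ⟧

      Off-nonRoot : ∀ v → Off v ≡ true → NonRoot v
      Off-nonRoot v e with ⟦⟧⁻ off? e
      ... | Vv , off = Vv , (λ { refl → off (subst OnPath (start walk) (onPath 0 z≤n)) })
                          , (λ { refl → off (subst OnPath (end walk) (onPath m ≤-refl)) })

      K₂-comp : Σ (Subset n) (Component G Off x₀)
      K₂-comp = component G Off x₀ (⟦⟧⁺ off? (proj₂ (proj₂ x₀-exists)))

      K₂ : Subset n
      K₂ = proj₁ K₂-comp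

      open Component (proj₂ K₂-comp)

      K₂-off : ∀ t → t ≤ m → K₂ (c t) ≡ false
      K₂-off t t≤m = ¬-not λ K₂t → proj₂ (⟦⟧⁻ off? (⊆U _ K₂t)) (onPath t t≤m)

      K₂-connected : Connected G (λ v → K₂ v ≡ true)
      K₂-connected = connected-from (Simple.sym simple) x₀ root path

      attached? : ∀ t → Dec (Attached G K₂ (c t))
      attached? t = any? λ y → K₂ y ≟ᵇ true ×-dec G y (c t) ≟ᵇ true

      attached-1 : Attached G K₂ (c 1)
      attached-1 = x₀ , root , trans (Simple.sym simple x₀ (c 1)) (proj₁ (proj₂ x₀-exists))

      attachment-on-path : ∀ k u → K₂ k ≡ true → V u ≡ true → G k u ≡ true → Off u ≡ false →
        ∃ λ t → t ≤ m × c t ≡ u × Attached G K₂ (c t)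
      attachment-on-path k u K₂k Vu e Off-u = on-path (between? c 0 (suc m) u)
        where
        on-path : Dec (OnPath u) → ∃ λ t → t ≤ m × c t ≡ u × Attached G K₂ (c t)
        on-path (yes (t , t<m+1 , _ , ct≡u)) =
          t , s≤s⁻¹ t<m+1 , ct≡u , k , K₂k , subst (λ v → G k v ≡ true) (sym ct≡u) e
        on-path (no off) = contradiction Off-u (≡true⇒≢false (⟦⟧⁺ off? (Vu , off)))

      m≢0 : m ≢ 0
      m≢0 refl = contradiction 2≤len λ ()

      m≢1 : m ≢ 1
      m≢1 refl = contradiction 2≤len λ { (s≤s ()) }

      two-attachments : ∀ j → j ≤ m → j ≢ 1 →
        (∀ t → t ≤ m → Attached G K₂ (c t) → t ≡ 1 ⊎ t ≡ j) → K4MinorIn H V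
      two-attachments j j≤m j≢1 only = cut j refl
        where
        attach : CutOff Off K₂ (c 1) (c j)
        attach k u K₂k Vu e Off-u = at-1-or-j (attachment-on-path k u K₂k Vu e Off-u)
          where
          at-1-or-j : ∀ {u} → (∃ λ t → t ≤ m × c t ≡ u × Attached G K₂ (c t)) →
            u ≡ c 1 ⊎ u ≡ c j
          at-1-or-j (t , t≤m , refl , att) = Sum.map (cong c) (cong c) (only t t≤m att)
        cut-off : ∀ {s} → (∃ λ t → t ≤ m × t ≢ 1 × t ≢ j × c t ≡ s) →
          ∀ {r} → Walk H (V ∖ piece K₂ (c 1) (c j)) (c 1) (c j) (suc r) → K4MinorIn H V
        cut-off (t , t≤m , t≢1 , t≢j , refl) =
          reduce Off-nonRoot (proj₂ K₂-comp) (on-V 1 1≤m) (on-V j j≤m)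
          (positions-differ (λ 1≡j → j≢1 (sym 1≡j)) 1≤m j≤m) attach (on-V t t≤m) (K₂-off t t≤m)
          (positions-differ t≢1 t≤m 1≤m) (positions-differ t≢j t≤m j≤m)
        cut : ∀ j′ → j′ ≡ j → K4MinorIn H V
        cut zero refl = cut-off (m , ≤-refl , m≢1 , m≢0 , refl)
          (edge-walk (addEdge⁺ G a b (trans (Simple.sym simple (c 1) (c 0)) (adjacent walk 0 1≤m))))
        cut (suc zero) refl = contradiction refl j≢1
        cut (suc (suc _)) refl = cut-off (0 , z≤n , (λ ()) , (λ ()) , refl)
          (sub-walk walk (λ _ _ → addEdge⁺ G a b) (s≤s z≤n) j≤m λ t 1<t t<j →
            let t≤m = ≤-trans (<⇒≤ t<j) j≤m in
            ∖⁺ V (piece K₂ (c 1) (c j)) (on-V t t≤m) (⟦⟧-false (piece? K₂ (c 1) (c j)) λ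
              { (inj₁ K₂t) → contradiction (K₂-off t t≤m) (≡true⇒≢false K₂t)
              ; (inj₂ (inj₁ same)) → positions-differ (λ t≡1 → <⇒≢ 1<t (sym t≡1)) t≤m 1≤m same
              ; (inj₂ (inj₂ same)) → positions-differ (<⇒≢ t<j) t≤m j≤m same }))

      three-attachments : ∀ {j l} → j ≢ 1 → l ≢ 1 → l ≢ j →
        j ≤ m × Attached G K₂ (c j) → l ≤ m × Attached G K₂ (c l) → K4MinorIn H V
      three-attachments j≢1 l≢1 l≢j att-j att-l = sorted
        (sort₃ (λ t → t ≤ m × Attached G K₂ (c t))
               (λ 1≡j → j≢1 (sym 1≡j)) (λ 1≡l → l≢1 (sym 1≡l)) (λ j≡l → l≢j (sym j≡l))
               (1≤m , attached-1) att-j att-l)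
        where
        sorted : (∃ λ i′ → ∃ λ j′ → ∃ λ l′ → i′ < j′ × j′ < l′ ×
                   (i′ ≤ m × Attached G K₂ (c i′)) × (j′ ≤ m × Attached G K₂ (c j′)) ×
                   (l′ ≤ m × Attached G K₂ (c l′))) → K4MinorIn H V
        sorted (_ , _ , _ , i′<j′ , j′<l′ , (_ , att-i′) , (_ , att-j′) , (l′≤m , att-l′)) =
          ThreeAttachments.minor G simple V walk distinct on-V
            (λ v K₂v → proj₁ (⟦⟧⁻ off? (⊆U v K₂v))) K₂-off K₂-connected
            i′<j′ j′<l′ l′≤m att-i′ att-j′ att-l′

      attachments-at : ∀ j → ¬ (∃ λ l → l < suc m × l ≢ 1 × l ≢ j × Attached G K₂ (c l)) →
        ∀ t → t ≤ m → Attached G K₂ (c t) → t ≡ 1 ⊎ t ≡ j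
      attachments-at j none t t≤m att = Sum.map₂
        (λ t≢1 → decidable-stable (t ≟ⁿ j) λ t≢j → none (t , s≤s t≤m , t≢1 , t≢j , att))
        (toSum (t ≟ⁿ 1))

      result : K4MinorIn H V
      result = second (anyUpTo? (λ j → ¬? (j ≟ⁿ 1) ×-dec attached? j) (suc m))
        where
        second : Dec (∃ λ j → j < suc m × j ≢ 1 × Attached G K₂ (c j)) → K4MinorIn H V
        second (no none) = two-attachments 0 z≤n (λ ()) (attachments-at 0 λ
          { (l , l<m+1 , l≢1 , _ , att) → none (l , l<m+1 , l≢1 , att) })
        second (yes (j , j<m+1 , j≢1 , att-j)) =
          third (anyUpTo? (λ l → ¬? (l ≟ⁿ 1) ×-dec ¬? (l ≟ⁿ j) ×-dec attached? l) (suc m))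
          where
          third : Dec (∃ λ l → l < suc m × l ≢ 1 × l ≢ j × Attached G K₂ (c l)) → K4MinorIn H V
          third (yes (l , l<m+1 , l≢1 , l≢j , att-l)) =
            three-attachments j≢1 l≢1 l≢j (s≤s⁻¹ j<m+1 , att-j) (s≤s⁻¹ l<m+1 , att-l)
          third (no none) = two-attachments j (s≤s⁻¹ j<m+1) j≢1 (attachments-at j none)

    NonRoots : Subset n
    NonRoots = ⟦ nonRoot? ⟧

    w₀ : Fin n
    w₀ = proj₁ inner

    K-comp : Σ (Subset n) (Component G NonRoots w₀)
    K-comp = component G NonRoots w₀ (⟦⟧⁺ nonRoot? (proj₂ inner))

    K : Subset n
    K = proj₁ K-comp

    open Component (proj₂ K-comp)

    K-nonRoot : ∀ v → K v ≡ true → NonRoot v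
    K-nonRoot v Kv = ⟦⟧⁻ nonRoot? (⊆U v Kv)

    attached-at-roots : CutOff NonRoots K a b
    attached-at-roots k u _ Vu _ out = by-cases (u ≟ a)
      where
      by-cases : Dec (u ≡ a) → u ≡ a ⊎ u ≡ b
      by-cases (yes u≡a) = inj₁ u≡a
      by-cases (no u≢a) = inj₂ (decidable-stable (u ≟ b) λ u≢b →
        contradiction out (≡true⇒≢false (⟦⟧⁺ nonRoot? (Vu , u≢a , u≢b))))

    reduce-along-edge : ∀ {p q s} → V p ≡ true → V q ≡ true → G p q ≡ true →
      CutOff NonRoots K p q → V s ≡ true → K s ≡ false → s ≢ p → s ≢ q → K4MinorIn H V
    reduce-along-edge Vp Vq e attach Vs Ks s≢p s≢q =
      reduce (λ v → ⟦⟧⁻ nonRoot?) (proj₂ K-comp) Vp Vq (Simple⇒irreflexive simple e) attach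
        Vs Ks s≢p s≢q (edge-walk (addEdge⁺ G a b e))

    Touches : Fin n → Set
    Touches r = ∃ λ k → K k ≡ true × G k r ≡ true

    touches? : ∀ r → Dec (Touches r)
    touches? r = any? λ k → K k ≟ᵇ true ×-dec G k r ≟ᵇ true

    -- K ∪ {r} is cut off by r and a neighbour of r in K.
    one-root : ∀ {r s} → Touches r → ¬ Touches s → r ≡ a × s ≡ b ⊎ r ≡ b × s ≡ a →
      K4MinorIn H V
    one-root {r} {s} (k , Kk , kr) no-s roots with roles roots
      where
      roles : r ≡ a × s ≡ b ⊎ r ≡ b × s ≡ a →
        V r ≡ true × V s ≡ true × K s ≡ false × s ≢ r ×
        (∀ {u} → u ≡ a ⊎ u ≡ b → u ≡ r ⊎ u ≡ s)
      roles (inj₁ (refl , refl)) =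
        a∈V , b∈V , proj₂ (roots∉ K-nonRoot) , (λ b≡a → a≢b (sym b≡a)) , id
      roles (inj₂ (refl , refl)) = b∈V , a∈V , proj₁ (roots∉ K-nonRoot) , a≢b , Sum.swap
    ... | Vr , Vs , Ks , s≢r , a/b = reduce-along-edge Vr (proj₁ (K-nonRoot k Kk))
      (trans (Simple.sym simple r k) kr) attach Vs Ks s≢r
      (λ { refl → contradiction Ks (≡true⇒≢false Kk) })
      where
      attach : CutOff NonRoots K r k
      attach k′ u Kk′ Vu e out = inj₁ (Sum.[ id , (λ { refl → contradiction (k′ , Kk′ , e) no-s }) ]
                                         (a/b (attached-at-roots k′ u Kk′ Vu e out)))

    result : K4MinorIn H V
    result = by-roots (touches? a) (touches? b)
      where
      Ka : K a ≡ false
      Ka = proj₁ (roots∉ K-nonRoot)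
      by-roots : Dec (Touches a) → Dec (Touches b) → K4MinorIn H V
      by-roots (yes (ka , Kka , ka-a)) (yes (kb , Kkb , kb-b)) = via-path
        (PathIn⇒Walk (PathIn-reverse (Simple.sym simple) root (path ka Kka) ++ᵖ path kb Kkb) Kka
          (trans (Simple.sym simple a ka) ka-a) kb-b)
        where
        via-path : (∃ λ m → Walk G K a b (suc (suc m))) → K4MinorIn H V
        via-path (_ , w) = ViaPath.result K-nonRoot
          (shortcut-free G simple K Ka (proj₂ (roots∉ K-nonRoot)) a≢b (s≤s (s≤s z≤n)) w)
      by-roots (yes touch-a) (no no-b) = one-root touch-a no-b (inj₁ (refl , refl))
      by-roots (no no-a) (yes touch-b) = one-root touch-b no-a (inj₂ (refl , refl))
      -- K is a component of G[V], cut off by any edge w₀x inside it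
      by-roots (no no-a) (no no-b) = isolated
        (neighbour-avoiding G V w₀ (deg≥3 w₀ (proj₁ (proj₂ inner)) w₀≢a w₀≢b) a b)
        where
        w₀≢a : w₀ ≢ a
        w₀≢a = proj₁ (proj₂ (proj₂ inner))
        w₀≢b : w₀ ≢ b
        w₀≢b = proj₂ (proj₂ (proj₂ inner))
        isolated : (∃ λ x → G w₀ x ≡ true × V x ≡ true × x ≢ a × x ≢ b) → K4MinorIn H V
        isolated (x , e , Vx , x≢a , x≢b) = reduce-along-edge (proj₁ (proj₂ inner)) Vx e attach a∈V Ka
          (λ a≡w₀ → w₀≢a (sym a≡w₀)) (λ a≡x → x≢a (sym a≡x))
          where
          attach : CutOff NonRoots K w₀ x
          attach k u Kk Vu e out with attached-at-roots k u Kk Vu e out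
          ... | inj₁ refl = contradiction (k , Kk , e) no-a
          ... | inj₂ refl = contradiction (k , Kk , e) no-b

  rooted-K4 : ∀ f → Claim f
  rooted-K4 zero {V} {a} size≤0 R = contradiction (≤-trans (size>0 V a (Rooted3.a∈V R)) size≤0) λ ()
  rooted-K4 (suc f) size≤ R = Step.result (rooted-K4 f) size≤ R

Rooted3⇒K4MinorIn : ∀ {n} {G : Graph n} → Simple G → ∀ {V a b} → Rooted3 G V a b →
  K4MinorIn (addEdge G a b) V
Rooted3⇒K4MinorIn {G = G} simple {V} = Induction.rooted-K4 G simple (size V) ≤-refl

-- List colouring

ListColouring : ∀ {n} → Graph n → ListAssignment n → Subset n → Set
ListColouring {n} G L T = Σ (Fin n → ℕ) λ f → (∀ v → T v ≡ true → f v ∈ L v) ×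
  (∀ u v → T u ≡ true → T v ≡ true → G u v ≡ true → f u ≢ f v)

-- A vertex v of T with few neighbours in T is coloured last; deg G v ∸ degIn G S v is the number
-- of neighbours of v outside S, which the list-size hypothesis already pays for.
module Degenerate {n : ℕ} (G : Graph n) (simple : Simple G) (S : Subset n) (L : ListAssignment n)
  {r : ℕ} (unique : ∀ v → S v ≡ true → Unique (L v))
  (long : ∀ v → S v ≡ true → r ∸ (deg G v ∸ degIn G S v) ≤ length (L v))
  (low : ∀ T → T ⊆ S → ∃ (λ v → T v ≡ true) →
         ∃ λ v → T v ≡ true × degIn G T v + (deg G v ∸ degIn G S v) < r) where

  private
    colour-last : ∀ {T} → T ⊆ S → ∀ v → T v ≡ true →
      degIn G T v + (deg G v ∸ degIn G S v) < r →
      ListColouring G L (T ∖ ⟦ _≟ v ⟧) → ListColouring G L T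
    colour-last {T} T⊆S v Tv low-v (c′ , c′∈L , c′-proper) = c , c∈L , c-proper
      where
      T′ : Subset n
      T′ = T ∖ ⟦ _≟ v ⟧
      T′⁺ : ∀ {u} → T u ≡ true → u ≢ v → T′ u ≡ true
      T′⁺ Tu u≢v = ∖⁺ T ⟦ _≟ v ⟧ Tu (⟦⟧-false (_≟ v) u≢v)
      neighbours : List (Fin n)
      neighbours = filter (λ u → G v u ∧ T′ u ≟ᵇ true) (allFin n)
      forbidden : List ℕ
      forbidden = map c′ neighbours
      fewer : length forbidden < length (L v)
      fewer = begin-strict
        length forbidden
          ≡⟨ trans (length-map c′ neighbours)
                   (length-filter≡count (λ u → G v u ∧ T′ u) (allFin n)) ⟩
        degIn G T′ v
          ≤⟨ degIn-mono G v (λ u _ T′u → proj₁ (∖⁻ T ⟦ _≟ v ⟧ T′u)) ⟩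
        degIn G T v
          <⟨ m+n≤o⇒m≤o∸n (suc (degIn G T v)) low-v ⟩
        r ∸ (deg G v ∸ degIn G S v)
          ≤⟨ long v (T⊆S v Tv) ⟩
        length (L v) ∎
        where open ≤-Reasoning
      free : ∃ λ k → k ∈ L v × k ∉ forbidden
      free = ∃-∉ (unique v (T⊆S v Tv)) fewer
      k : ℕ
      k = proj₁ free
      k-free : ∀ {u} → T u ≡ true → G v u ≡ true → u ≢ v → k ≢ c′ u
      k-free {u} Tu e u≢v k≡c′u = proj₂ (proj₂ free) (subst (_∈ forbidden) (sym k≡c′u)
        (∈-map⁺ c′ (∈-filter⁺ (λ u → G v u ∧ T′ u ≟ᵇ true) (∈-allFin u)
                               (∧-intro e (T′⁺ Tu u≢v)))))
      c : Fin n → ℕ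
      c u = if ⌊ u ≟ v ⌋ then k else c′ u
      c∈L : ∀ u → T u ≡ true → c u ∈ L u
      c∈L u Tu with u ≟ v
      ... | yes refl = proj₁ (proj₂ free)
      ... | no u≢v = c′∈L u (T′⁺ Tu u≢v)
      c-proper : ∀ x y → T x ≡ true → T y ≡ true → G x y ≡ true → c x ≢ c y
      c-proper x y Tx Ty e with x ≟ v | y ≟ v
      ... | yes refl | yes refl = contradiction refl (Simple⇒irreflexive simple e)
      ... | yes refl | no y≢v = k-free Ty e y≢v
      ... | no x≢v | yes refl =
        λ c′x≡k → k-free Tx (trans (Simple.sym simple v x) e) x≢v (sym c′x≡k)
      ... | no x≢v | no y≢v = c′-proper x y (T′⁺ Tx x≢v) (T′⁺ Ty y≢v) e

  colour : ∀ T → T ⊆ S → ListColouring G L T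
  colour T = go (size T) T ≤-refl
    where
    go : ∀ f T → size T ≤ f → T ⊆ S → ListColouring G L T
    go f T size≤ T⊆S with any? (λ v → T v ≟ᵇ true)
    ... | no empty =
      (λ _ → 0) , (λ v Tv → contradiction (v , Tv) empty) , λ u _ Tu → contradiction (u , Tu) empty
    ... | yes nonempty with f | low T T⊆S nonempty
    ...   | zero | v , Tv , _ = contradiction (≤-trans (size>0 T v Tv) size≤) λ ()
    ...   | suc f′ | v , Tv , low-v = colour-last T⊆S v Tv low-v
      (go f′ T′ (s≤s⁻¹ (<-≤-trans (size-< T′ T T′⊆T v T′v Tv) size≤))
          λ u T′u → T⊆S u (T′⊆T u T′u))
      where
      T′ : Subset n
      T′ = T ∖ ⟦ _≟ v ⟧
      T′⊆T : T′ ⊆ T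
      T′⊆T u T′u = proj₁ (∖⁻ T ⟦ _≟ v ⟧ T′u)
      T′v : T′ v ≡ false
      T′v = ¬-not λ T′v →
        contradiction (proj₂ (∖⁻ T ⟦ _≟ v ⟧ T′v)) (≡true⇒≢false (⟦⟧⁺ (_≟ v) refl))

-- The pocket

module _ {n : ℕ} {G : Graph n} (simple : Simple G) {S : Subset n} {a b : Fin n}
  (coboundary : CoboundaryIs G S a b) where

  private
    outside-at-roots : ∀ w → S w ≡ false × (∃ λ u → S u ≡ true × G w u ≡ true) →
      w ≡ a ⊎ w ≡ b
    outside-at-roots = proj₁ (proj₂ coboundary)

    roots-outside : ∀ {r} → r ≡ a ⊎ r ≡ b → S r ≡ false
    roots-outside {r} r∈ = proj₁ (proj₂ (proj₂ coboundary) r r∈)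

  -- The neighbours of v ∈ S outside S lie in {a, b}.
  degIn+excess≤ : ∀ T → T ⊆ S → ∀ v → S v ≡ true →
    degIn G T v + (deg G v ∸ degIn G S v) ≤ degIn G (piece T a b) v
  degIn+excess≤ T T⊆S v Sv rewrite excess≡ G S v = begin
    degIn G T v + count (λ u → (G v u ∧ true) ∧ not (S u)) (allFin n)
      ≤⟨ +-mono-≤ (count-mono _ _ (allFin n) inside) (count-mono _ _ (allFin n) outside) ⟩
    count (λ u → (G v u ∧ V u) ∧ T u) (allFin n) +
    count (λ u → (G v u ∧ V u) ∧ not (T u)) (allFin n)
      ≡⟨ count-split (λ u → G v u ∧ V u) T (allFin n) ⟨
    degIn G V v ∎
    where
    open ≤-Reasoning
    V : Subset n
    V = piece T a b
    inside : ∀ u → G v u ∧ T u ≡ true → (G v u ∧ V u) ∧ T u ≡ true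
    inside u e = ∧-intro (∧-intro (∧-conicalˡ _ _ e) (⟦⟧⁺ (piece? T a b) (inj₁ Tu))) Tu
      where
      Tu : T u ≡ true
      Tu = ∧-conicalʳ (G v u) _ e
    outside : ∀ u → (G v u ∧ true) ∧ not (S u) ≡ true → (G v u ∧ V u) ∧ not (T u) ≡ true
    outside u e = ∧-intro (∧-intro Gvu (⟦⟧⁺ (piece? T a b) (inj₂ u-root)))
                          (cong not (¬-not λ Tu → contradiction Su (≡true⇒≢false (T⊆S u Tu))))
      where
      Gvu : G v u ≡ true
      Gvu = ∧-conicalˡ (G v u) _ (∧-conicalˡ (G v u ∧ true) _ e)
      Su : S u ≡ false
      Su = not-injective {y = false} (∧-conicalʳ (G v u ∧ true) _ e)
      u-root : u ≡ a ⊎ u ≡ b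
      u-root = outside-at-roots u (Su , v , Sv , trans (Simple.sym simple u v) Gvu)

  -- Otherwise T ∪ {a, b} satisfies Rooted3, so G + ab would have a K4 minor.
  low-vertex : K4MinorFree (addEdge G a b) → ∀ T → T ⊆ S → ∃ (λ v → T v ≡ true) →
    ∃ λ v → T v ≡ true × degIn G T v + (deg G v ∸ degIn G S v) < 4
  low-vertex k4-free T T⊆S (w₀ , Tw₀)
    with any? (λ v → T v ≟ᵇ true ×-dec degIn G T v + (deg G v ∸ degIn G S v) <? 4)
  ... | yes (v , Tv , low) = v , Tv , low
  ... | no none = contradiction (proj₁ (Rooted3⇒K4MinorIn simple R)) k4-free
    where
    V : Subset n
    V = piece T a b
    ∉S : ∀ {u w} → S u ≡ false → T w ≡ true → w ≢ u
    ∉S Su Tw refl = contradiction Su (≡true⇒≢false (T⊆S _ Tw))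
    deg≥3 : ∀ w → V w ≡ true → w ≢ a → w ≢ b → 3 ≤ degIn G V w
    deg≥3 w Vw w≢a w≢b with ⟦⟧⁻ (piece? T a b) Vw
    ... | inj₂ (inj₁ w≡a) = contradiction w≡a w≢a
    ... | inj₂ (inj₂ w≡b) = contradiction w≡b w≢b
    ... | inj₁ Tw = ≤-trans (≤-trans (n≤1+n 3) (≮⇒≥ λ low → none (w , Tw , low)))
                            (degIn+excess≤ T T⊆S w (T⊆S w Tw))
    R : Rooted3 G V a b
    R = record
      { a≢b = proj₁ coboundary
      ; a∈V = ⟦⟧⁺ (piece? T a b) (inj₂ (inj₁ refl))
      ; b∈V = ⟦⟧⁺ (piece? T a b) (inj₂ (inj₂ refl))
      ; inner = w₀ , ⟦⟧⁺ (piece? T a b) (inj₁ Tw₀) , ∉S (roots-outside (inj₁ refl)) Tw₀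
                   , ∉S (roots-outside (inj₂ refl)) Tw₀
      ; deg≥3 = deg≥3 }

mainTheorem11 : (n : ℕ) (G : Graph n) → Simple G → K4MinorFree G →
    (C : ℕ) → 1 ≤ C → (S : Subset n) → IsPocket G C S →
    (a b : Fin n) → CoboundaryIs G S a b → K4MinorFree (addEdge G a b) →
    Deletable 4 G S
mainTheorem11 _ G simple _ _ _ S pocket a b coboundary k4-free =
  proj₁ (proj₁ pocket) , λ L unique long →
    Degenerate.colour G simple S L unique long (low-vertex simple coboundary k4-free) S λ _ Sv → Sv
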